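{- Let $G$ be a subcubic graph containing eight distinct vertices $1,2,6,x,3,4,5,y$ that induce the graph $\Theta$ with edge set $\{12,2x,x6,61,\;34,45,5y,y3,\;23,65,xy\}$. Then $\alpha(G-\{x,y\})=\alpha(G)-1$.
   Context: Graphs are finite, simple, undirected; subcubic means maximum degree at most $3$; $\alpha(G)$ denotes the maximum size of an independent set of $G$, and $G-\{x,y\}$ is the graph obtained by deleting vertices $x$ and $y$. -}

module Defs where

open import Data.Nat using (ℕ; zero; suc; _≤_; _⊔_; _+_; _≡ᵇ_)
open import Data.Bool using (Bool; true; false; _∧_; _∨_; not; if_then_else_)
open import Data.Fin using (Fin; toℕ)
open import Data.Fin.Subset using (Subset; inside; outside; ⊤; ∣_∣; ∁; ⁅_⁆; _∪_)
import Data.Fin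
open import Data.Vec using (Vec; []; _∷_; lookup)
open import Data.List using (List; []; _∷_; [_]; _++_; map; foldr; allFin)
open import Data.Nat.ListAction using (sum)
open import Data.Bool.ListAction using (all; any)
open import Data.Product using (_×_; _,_)
open import Relation.Binary.PropositionalEquality using (_≡_)
open import Function.Definitions using (Injective)

record Graph (n : ℕ) : Set where
  field
    adj    : Fin n → Fin n → Bool
    adj-sym    : ∀ u v → adj u v ≡ adj v u
    adj-irrefl : ∀ v → adj v v ≡ false
open Graph public

degree : ∀ {n} → Graph n → Fin n → ℕ
degree {n} G v = sum (map (λ u → if adj G v u then 1 else 0) (allFin n))

Subcubic : ∀ {n} → Graph n → Set
Subcubic {n} G = ∀ v → degree G v ≤ 3

allSubsets : ∀ n → List (Subset n)
allSubsets zero    = [ [] ]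
allSubsets (suc n) = map (inside ∷_) (allSubsets n) ++ map (outside ∷_) (allSubsets n)

isIndependent : ∀ {n} → Graph n → Subset n → Bool
isIndependent {n} G S =
  all (λ u → all (λ v → not (lookup S u ∧ lookup S v ∧ adj G u v)) (allFin n)) (allFin n)

isSubsetOf : ∀ {n} → Subset n → Subset n → Bool
isSubsetOf {n} S U = all (λ u → not (lookup S u) ∨ lookup U u) (allFin n)

-- independence number of the induced subgraph G[U]:
-- the maximum size of an independent set of G contained in U
-- (the independent sets of G[U] are exactly these sets).
αOn : ∀ {n} → Graph n → Subset n → ℕ
αOn {n} G U =
  foldr _⊔_ 0 (map (λ S → if isIndependent G S ∧ isSubsetOf S U then ∣ S ∣ else 0) (allSubsets n))

α : ∀ {n} → Graph n → ℕ
α G = αOn G ⊤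

-- The graph Θ on Fin 8, vertices labelled in the order 1,2,6,x,3,4,5,y
-- (so 1↦0, 2↦1, 6↦2, x↦3, 3↦4, 4↦5, 5↦6, y↦7).
-- Edges: 12, 2x, x6, 61, 34, 45, 5y, y3, 23, 65, xy.
ΘEdges : List (ℕ × ℕ)
ΘEdges = (0 , 1) ∷ (1 , 3) ∷ (3 , 2) ∷ (2 , 0) ∷
         (4 , 5) ∷ (5 , 6) ∷ (6 , 7) ∷ (7 , 4) ∷
         (1 , 4) ∷ (2 , 6) ∷ (3 , 7) ∷ []

ΘAdj : Fin 8 → Fin 8 → Bool
ΘAdj i j = any (λ { (a , b) → ((toℕ i ≡ᵇ a) ∧ (toℕ j ≡ᵇ b)) ∨ ((toℕ i ≡ᵇ b) ∧ (toℕ j ≡ᵇ a)) }) ΘEdges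

InducesΘ : ∀ {n} → Graph n → (Fin 8 → Fin n) → Set
InducesΘ G f = Injective _≡_ _≡_ f × (∀ i j → adj G (f i) (f j) ≡ ΘAdj i j)

θx θy : Fin 8
θx = Data.Fin.suc (Data.Fin.suc (Data.Fin.suc Data.Fin.zero))
θy = Data.Fin.suc (Data.Fin.suc (Data.Fin.suc (Data.Fin.suc (Data.Fin.suc (Data.Fin.suc (Data.Fin.suc Data.Fin.zero))))))

without₂ : ∀ {n} → Fin n → Fin n → Subset n
without₂ x y = ∁ (⁅ x ⁆ ∪ ⁅ y ⁆)

module Submission where

-- Every independent set S of G − {x,y} extends to a larger independent set of G: add x if S
-- avoids its neighbours 2 and 6, add y if S avoids 3 and 5; otherwise, since 23 and 65 are
-- edges, S contains 2 and 5 but not 6 and 3 (or symmetrically), and S − 2 + x + 3 is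
-- independent because the only neighbour 4 of 3 outside {2,y} is adjacent to 5 ∈ S.
-- Subcubicity is what guarantees that the neighbours inside Θ are all the neighbours.
-- Conversely, x and y are adjacent, so deleting them loses at most one vertex of any
-- independent set of G.

open import Defs
open import Data.Bool using (Bool; true; false; T; _∧_; _∨_; not; if_then_else_)
open import Data.Bool.Properties using (T-≡; ¬-not)
open import Data.Bool.ListAction using (all)
open import Data.Fin using (Fin; zero; suc; _≟_; #_)
open import Data.Fin.Subset using (Subset; inside; outside; ⊤; ∣_∣; ⁅_⁆; _∪_; _-_; _∈_; _∉_; _⊆_)
open import Data.Fin.Subset.Properties
  using (_∈?_; ⊆⊤; x∈⁅x⁆; x∈⁅y⁆⇒x≡y; x∈p∪q⁺; x∈p∪q⁻; x∈∁p⇒x∉p; x∉p⇒x∈∁p; p─q⊆p; ∪-identityʳ;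
         x∈p∧x≢y⇒x∈p-y; x∈p⇒∣p-x∣<∣p∣; p⊆q⇒∣p∣≤∣q∣)
open import Data.List using (List; []; _∷_; length; allFin; map; foldr)
import Data.List as List
open import Data.List.Properties using (map-tabulate)
open import Data.List.Membership.Propositional.Properties using (∈-allFin; ∈-map⁺; ∈-++⁺ˡ; ∈-++⁺ʳ)
import Data.List.Membership.Propositional as List
open import Data.List.Relation.Unary.All as All using (All; []; _∷_)
open import Data.List.Relation.Unary.All.Properties using (all⁺; all⁻; map⁺)
import Data.List.Relation.Unary.Any as Any
open import Data.List.Relation.Unary.Unique.Propositional using (Unique; []; _∷_)
open import Data.List.Properties using (foldr-preservesᵇ; foldr-preservesᵒ)
open import Data.Nat using (ℕ; zero; suc; _≤_; _<_; _⊔_; _∸_; z≤n; s≤s)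
open import Data.Nat.ListAction using (sum)
open import Data.Nat.Properties
  using (module ≤-Reasoning; ≤-reflexive; ≤-trans; ≤-antisym; <-irrefl; ⊔-lub; m≤n⇒m≤n⊔o; m≤n⇒m≤o⊔n; ∸-monoˡ-≤)
open import Data.Product using (Σ-syntax; _×_; _,_; proj₁; proj₂)
open import Data.Sum using (_⊎_; inj₁; inj₂; [_,_])
open import Data.Vec using ([]; _∷_; lookup; tabulate; here; there)
open import Data.Vec.Properties using (lookup∘tabulate; lookup-zipWith; []=⇒lookup; lookup⇒[]=)
open import Function using (case_of_; _∘_; id; _⇔_; mk⇔; Equivalence)
open import Relation.Nullary using (yes; no; contradiction)
open import Relation.Binary.PropositionalEquality using (_≡_; _≢_; refl; sym; trans; cong; subst)

open Equivalence using (to; from)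

private
  variable
    n : ℕ

-- `_-_` is defined with a local helper that does not unfold along the vector, hence `lookup`.
x∉p-x : ∀ (p : Subset n) x → x ∉ p - x
x∉p-x p x x∈p-x with trans (sym ([]=⇒lookup x∈p-x)) (lookup-zipWith _ x p ⁅ x ⁆)
... | inside≡diff rewrite []=⇒lookup (x∈⁅x⁆ x) = case inside≡diff of λ ()

x∉p⇒x∉p-y : ∀ {p : Subset n} {x} y → x ∉ p → x ∉ p - y
x∉p⇒x∉p-y {p = p} y x∉p = x∉p ∘ p─q⊆p p ⁅ y ⁆

x∉p⇒∣p∪⁅x⁆∣≡1+∣p∣ : ∀ {p : Subset n} {x} → x ∉ p → ∣ p ∪ ⁅ x ⁆ ∣ ≡ suc ∣ p ∣
x∉p⇒∣p∪⁅x⁆∣≡1+∣p∣ {p = inside  ∷ p} {zero}  x∉p = contradiction here x∉p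
x∉p⇒∣p∪⁅x⁆∣≡1+∣p∣ {p = outside ∷ p} {zero}  x∉p = cong (suc ∘ ∣_∣) (∪-identityʳ p)
x∉p⇒∣p∪⁅x⁆∣≡1+∣p∣ {p = inside  ∷ p} {suc x} x∉p = cong suc (x∉p⇒∣p∪⁅x⁆∣≡1+∣p∣ (x∉p ∘ there))
x∉p⇒∣p∪⁅x⁆∣≡1+∣p∣ {p = outside ∷ p} {suc x} x∉p = x∉p⇒∣p∪⁅x⁆∣≡1+∣p∣ (x∉p ∘ there)

Unique⇒length≤∣p∣ : ∀ {p : Subset n} {xs} → Unique xs → All (_∈ p) xs → length xs ≤ ∣ p ∣
Unique⇒length≤∣p∣ [] [] = z≤n
Unique⇒length≤∣p∣ (x≢xs ∷ unique) (x∈p ∷ xs⊆p) =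
  ≤-trans (s≤s (Unique⇒length≤∣p∣ unique xs⊆p-x)) (x∈p⇒∣p-x∣<∣p∣ x∈p)
  where
  xs⊆p-x = All.zipWith (λ (y∈p , x≢y) → x∈p∧x≢y⇒x∈p-y y∈p (x≢y ∘ sym)) (xs⊆p , x≢xs)

p⊆[p-x]∪⁅x⁆ : ∀ (p : Subset n) x → p ⊆ (p - x) ∪ ⁅ x ⁆
p⊆[p-x]∪⁅x⁆ p x {y} y∈p with y ≟ x
... | yes refl = x∈p∪q⁺ (inj₂ (x∈⁅x⁆ x))
... | no y≢x   = x∈p∪q⁺ (inj₁ (x∈p∧x≢y⇒x∈p-y y∈p y≢x))

∣p∣≤1+∣p-x∣ : ∀ (p : Subset n) x → ∣ p ∣ ≤ suc ∣ p - x ∣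
∣p∣≤1+∣p-x∣ p x = ≤-trans (p⊆q⇒∣p∣≤∣q∣ (p⊆[p-x]∪⁅x⁆ p x)) (≤-reflexive (x∉p⇒∣p∪⁅x⁆∣≡1+∣p∣ (x∉p-x p x)))

≤-foldr-⊔ : ∀ {m} {ms : List ℕ} → m List.∈ ms → m ≤ foldr _⊔_ 0 ms
≤-foldr-⊔ m∈ms = foldr-preservesᵒ (λ k l → [ m≤n⇒m≤n⊔o l , m≤n⇒m≤o⊔n k ]) 0 _ (inj₂ (Any.map ≤-reflexive m∈ms))

foldr-⊔-≤ : ∀ {k} {ms : List ℕ} → All (_≤ k) ms → foldr _⊔_ 0 ms ≤ k
foldr-⊔-≤ = foldr-preservesᵇ ⊔-lub z≤n

T-all-allFin : ∀ (q : Fin n → Bool) → T (all q (allFin n)) ⇔ (∀ i → T (q i))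
T-all-allFin q = mk⇔
  (λ t i → All.lookup (all⁺ q _ t) (∈-allFin i))
  (λ t → all⁻ q {xs = allFin _} (All.tabulate (λ {i} _ → t i)))

∈⇔T-lookup : ∀ {p : Subset n} {x} → x ∈ p ⇔ T (lookup p x)
∈⇔T-lookup {p = p} {x} = mk⇔ (from T-≡ ∘ []=⇒lookup) (lookup⇒[]= x p ∘ to T-≡)

T-¬∨ : ∀ a b → T (not a ∨ b) ⇔ (T a → T b)
T-¬∨ false b = mk⇔ (λ _ ()) _
T-¬∨ true  b = mk⇔ (λ t _ → t) (λ t → t _)

T-¬∧∧ : ∀ a b c → T (not (a ∧ b ∧ c)) ⇔ (T a → T b → c ≡ false)
T-¬∧∧ false b     c     = mk⇔ (λ _ ()) _
T-¬∧∧ true  false c     = mk⇔ (λ _ _ ()) _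
T-¬∧∧ true  true  false = mk⇔ (λ _ _ _ → refl) _
T-¬∧∧ true  true  true  = mk⇔ (λ ()) (λ t → case t _ _ of λ ())

record Independent (G : Graph n) (S : Subset n) : Set where
  constructor independent
  field
    nonadjacent : ∀ {u v} → u ∈ S → v ∈ S → adj G u v ≡ false

open Independent

T-isIndependent : ∀ (G : Graph n) S → T (isIndependent G S) ⇔ Independent G S
T-isIndependent {n} G S = mk⇔
  (λ t → independent λ {u} {v} u∈S v∈S → to (T-¬∧∧ _ _ _) (entry u v t) (to ∈⇔T-lookup u∈S) (to ∈⇔T-lookup v∈S))
  (λ ind → from (T-all-allFin row) λ u → from (T-all-allFin (edgeFree u)) λ v →
     from (T-¬∧∧ _ _ (adj G u v)) λ u∈S v∈S → nonadjacent ind (from ∈⇔T-lookup u∈S) (from ∈⇔T-lookup v∈S))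
  where
  edgeFree : Fin n → Fin n → Bool
  edgeFree u v = not (lookup S u ∧ lookup S v ∧ adj G u v)
  row : Fin n → Bool
  row u = all (edgeFree u) (allFin n)
  entry : ∀ u v → T (isIndependent G S) → T (edgeFree u v)
  entry u v t = to (T-all-allFin (edgeFree u)) (to (T-all-allFin row) t u) v

T-isSubsetOf : ∀ (S U : Subset n) → T (isSubsetOf S U) ⇔ S ⊆ U
T-isSubsetOf S U = mk⇔
  (λ t {u} u∈S → from ∈⇔T-lookup (to (T-¬∨ _ _) (to (T-all-allFin member) t u) (to ∈⇔T-lookup u∈S)))
  (λ S⊆U → from (T-all-allFin member) λ u → from (T-¬∨ (lookup S u) _) (to ∈⇔T-lookup ∘ S⊆U ∘ from ∈⇔T-lookup))
  where
  member : Fin _ → Bool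
  member u = not (lookup S u) ∨ lookup U u

∈-allSubsets : ∀ (S : Subset n) → S List.∈ allSubsets n
∈-allSubsets []            = Any.here refl
∈-allSubsets (inside  ∷ S) = ∈-++⁺ˡ (∈-map⁺ (inside ∷_) (∈-allSubsets S))
∈-allSubsets (outside ∷ S) = ∈-++⁺ʳ (map (inside ∷_) (allSubsets _)) (∈-map⁺ (outside ∷_) (∈-allSubsets S))

module _ (G : Graph n) (U : Subset n) where

  private
    score : Subset n → ℕ
    score S = if isIndependent G S ∧ isSubsetOf S U then ∣ S ∣ else 0

  ∣S∣≤αOn : ∀ {S} → Independent G S → S ⊆ U → ∣ S ∣ ≤ αOn G U
  ∣S∣≤αOn {S} ind S⊆U = ≤-trans (≤-reflexive (sym score≡∣S∣)) (≤-foldr-⊔ (∈-map⁺ score (∈-allSubsets S)))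
    where
    score≡∣S∣ : score S ≡ ∣ S ∣
    score≡∣S∣ rewrite to T-≡ (from (T-isIndependent G S) ind) | to T-≡ (from (T-isSubsetOf S U) S⊆U) = refl

  αOn≤ : ∀ {k} → (∀ {S} → Independent G S → S ⊆ U → ∣ S ∣ ≤ k) → αOn G U ≤ k
  αOn≤ {k} bound = foldr-⊔-≤ (map⁺ (All.universal score≤k (allSubsets n)))
    where
    score≤k : ∀ S → score S ≤ k
    score≤k S with isIndependent G S in ind | isSubsetOf S U in S⊆U
    ... | true  | true  = bound (to (T-isIndependent G S) (from T-≡ ind)) (to (T-isSubsetOf S U) (from T-≡ S⊆U))
    ... | true  | false = z≤n
    ... | false | _     = z≤n

NoNeighbourIn : Graph n → Fin n → Subset n → Set
NoNeighbourIn G v S = ∀ {w} → adj G v w ≡ true → w ∉ S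

module _ {G : Graph n} where

  Independent-⊆ : ∀ {S T} → T ⊆ S → Independent G S → Independent G T
  Independent-⊆ T⊆S ind = independent λ u∈T v∈T → nonadjacent ind (T⊆S u∈T) (T⊆S v∈T)

  Independent⇒∉ : ∀ {S u w} → Independent G S → u ∈ S → adj G u w ≡ true → w ∉ S
  Independent⇒∉ ind u∈S u~w w∈S = case trans (sym u~w) (nonadjacent ind u∈S w∈S) of λ ()

  NoNeighbourIn⇒≁ : ∀ {v S w} → NoNeighbourIn G v S → w ∈ S → adj G v w ≡ false
  NoNeighbourIn⇒≁ free w∈S = ¬-not (λ v~w → free v~w w∈S)

  Independent-∪⁅⁆ : ∀ {S v} → Independent G S → NoNeighbourIn G v S → Independent G (S ∪ ⁅ v ⁆)
  Independent-∪⁅⁆ {S} {v} ind free = independent nonadjacent′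
    where
    nonadjacent′ : ∀ {u w} → u ∈ S ∪ ⁅ v ⁆ → w ∈ S ∪ ⁅ v ⁆ → adj G u w ≡ false
    nonadjacent′ {u} {w} u∈ w∈ with x∈p∪q⁻ S ⁅ v ⁆ u∈ | x∈p∪q⁻ S ⁅ v ⁆ w∈
    ... | inj₁ u∈S | inj₁ w∈S = nonadjacent ind u∈S w∈S
    ... | inj₁ u∈S | inj₂ w∈⁅v⁆ rewrite x∈⁅y⁆⇒x≡y v w∈⁅v⁆ = trans (adj-sym G u v) (NoNeighbourIn⇒≁ free u∈S)
    ... | inj₂ u∈⁅v⁆ | inj₁ w∈S rewrite x∈⁅y⁆⇒x≡y v u∈⁅v⁆ = NoNeighbourIn⇒≁ free w∈S
    ... | inj₂ u∈⁅v⁆ | inj₂ w∈⁅v⁆ rewrite x∈⁅y⁆⇒x≡y v u∈⁅v⁆ | x∈⁅y⁆⇒x≡y v w∈⁅v⁆ = adj-irrefl G v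

  LargerIndependentSet : Subset n → Set
  LargerIndependentSet S = Σ[ T ∈ Subset n ] Independent G T × ∣ S ∣ < ∣ T ∣

  extend : ∀ {S v} → Independent G S → v ∉ S → NoNeighbourIn G v S → LargerIndependentSet S
  extend {S} {v} ind v∉S free = S ∪ ⁅ v ⁆ , Independent-∪⁅⁆ ind free , ≤-reflexive (sym (x∉p⇒∣p∪⁅x⁆∣≡1+∣p∣ v∉S))

  exchange : ∀ {S a u v} → Independent G S → u ∉ S → v ∉ S → u ≢ v → adj G v u ≡ false →
    NoNeighbourIn G u (S - a) → NoNeighbourIn G v (S - a) → LargerIndependentSet S
  exchange {S} {a} {u} {v} ind u∉S v∉S u≢v v≁u u-free v-free =
    ((S - a) ∪ ⁅ u ⁆) ∪ ⁅ v ⁆ ,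
    Independent-∪⁅⁆ (Independent-∪⁅⁆ (Independent-⊆ (p─q⊆p S ⁅ a ⁆) ind) u-free) v-free′ ,
    larger
    where
    u∉S-a : u ∉ S - a
    u∉S-a = x∉p⇒x∉p-y a u∉S
    v∉S-a∪u : v ∉ (S - a) ∪ ⁅ u ⁆
    v∉S-a∪u = [ x∉p⇒x∉p-y a v∉S , u≢v ∘ sym ∘ x∈⁅y⁆⇒x≡y u ] ∘ x∈p∪q⁻ (S - a) ⁅ u ⁆
    v-free′ : NoNeighbourIn G v ((S - a) ∪ ⁅ u ⁆)
    v-free′ v~w w∈ with x∈p∪q⁻ (S - a) ⁅ u ⁆ w∈
    ... | inj₁ w∈S-a = v-free v~w w∈S-a
    ... | inj₂ w∈⁅u⁆ rewrite x∈⁅y⁆⇒x≡y u w∈⁅u⁆ = case trans (sym v~w) v≁u of λ ()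
    open ≤-Reasoning
    larger : ∣ S ∣ < ∣ ((S - a) ∪ ⁅ u ⁆) ∪ ⁅ v ⁆ ∣
    larger = begin-strict
      ∣ S ∣                         ≤⟨ ∣p∣≤1+∣p-x∣ S a ⟩
      suc ∣ S - a ∣                 ≡⟨ x∉p⇒∣p∪⁅x⁆∣≡1+∣p∣ u∉S-a ⟨
      ∣ (S - a) ∪ ⁅ u ⁆ ∣           <⟨ ≤-reflexive (sym (x∉p⇒∣p∪⁅x⁆∣≡1+∣p∣ v∉S-a∪u)) ⟩
      ∣ ((S - a) ∪ ⁅ u ⁆) ∪ ⁅ v ⁆ ∣ ∎

neighbourhood : Graph n → Fin n → Subset n
neighbourhood G v = tabulate (adj G v)

sum-indicator≡∣tabulate∣ : ∀ (h : Fin n → Bool) → sum (List.tabulate (λ u → if h u then 1 else 0)) ≡ ∣ tabulate h ∣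
sum-indicator≡∣tabulate∣ {zero}  h = refl
sum-indicator≡∣tabulate∣ {suc n} h with h zero
... | true  = cong suc (sum-indicator≡∣tabulate∣ (h ∘ suc))
... | false = sum-indicator≡∣tabulate∣ (h ∘ suc)

degree≡∣neighbourhood∣ : ∀ (G : Graph n) v → degree G v ≡ ∣ neighbourhood G v ∣
degree≡∣neighbourhood∣ G v =
  trans (cong sum (map-tabulate id (λ u → if adj G v u then 1 else 0))) (sum-indicator≡∣tabulate∣ (adj G v))

adj⇒∈neighbourhood : ∀ (G : Graph n) {v w} → adj G v w ≡ true → w ∈ neighbourhood G v
adj⇒∈neighbourhood G {v} {w} v~w = lookup⇒[]= w _ (trans (lookup∘tabulate (adj G v) w) v~w)

degree≤3⇒neighbours : ∀ (G : Graph n) {v a b c w} → degree G v ≤ 3 →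
  a ≢ b → a ≢ c → b ≢ c → adj G v a ≡ true → adj G v b ≡ true → adj G v c ≡ true →
  adj G v w ≡ true → w ≡ a ⊎ w ≡ b ⊎ w ≡ c
degree≤3⇒neighbours G {v} {a} {b} {c} {w} deg≤3 a≢b a≢c b≢c v~a v~b v~c v~w with w ≟ a | w ≟ b | w ≟ c
... | yes w≡a | _       | _       = inj₁ w≡a
... | no _    | yes w≡b | _       = inj₂ (inj₁ w≡b)
... | no _    | no _    | yes w≡c = inj₂ (inj₂ w≡c)
... | no w≢a  | no w≢b  | no w≢c  = contradiction (≤-trans 4≤degree deg≤3) (<-irrefl refl)
  where
  distinct : Unique (a ∷ b ∷ c ∷ w ∷ [])
  distinct = (a≢b ∷ a≢c ∷ (w≢a ∘ sym) ∷ []) ∷ (b≢c ∷ (w≢b ∘ sym) ∷ []) ∷ ((w≢c ∘ sym) ∷ []) ∷ [] ∷ []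
  4≤degree : 4 ≤ degree G v
  4≤degree = subst (4 ≤_) (sym (degree≡∣neighbourhood∣ G v))
    (Unique⇒length≤∣p∣ distinct (All.map (adj⇒∈neighbourhood G) (v~a ∷ v~b ∷ v~c ∷ v~w ∷ [])))

module _ {S : Subset n} {a b : Fin n} where

  ⊆without₂⇒∉ : S ⊆ without₂ a b → a ∉ S × b ∉ S
  ⊆without₂⇒∉ S⊆W =
    (λ a∈S → x∈∁p⇒x∉p (S⊆W a∈S) (x∈p∪q⁺ (inj₁ (x∈⁅x⁆ a)))) ,
    (λ b∈S → x∈∁p⇒x∉p (S⊆W b∈S) (x∈p∪q⁺ (inj₂ (x∈⁅x⁆ b))))

  ∉⇒⊆without₂ : a ∉ S → b ∉ S → S ⊆ without₂ a b
  ∉⇒⊆without₂ a∉S b∉S {w} w∈S = x∉p⇒x∈∁p ([ excluded a∉S , excluded b∉S ] ∘ x∈p∪q⁻ ⁅ a ⁆ ⁅ b ⁆)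
    where
    excluded : ∀ {c} → c ∉ S → w ∉ ⁅ c ⁆
    excluded c∉S w∈⁅c⁆ = c∉S (subst (_∈ S) (x∈⁅y⁆⇒x≡y _ w∈⁅c⁆) w∈S)

module _ (G : Graph n) {x y : Fin n} where

  α≤1+αOn-without₂ : adj G x y ≡ true → α G ≤ suc (αOn G (without₂ x y))
  α≤1+αOn-without₂ x~y = αOn≤ G ⊤ bound
    where
    bound : ∀ {S} → Independent G S → S ⊆ ⊤ → ∣ S ∣ ≤ suc (αOn G (without₂ x y))
    bound {S} ind _ with x ∈? S
    ... | yes x∈S = ≤-trans (∣p∣≤1+∣p-x∣ S x) (s≤s (∣S∣≤αOn G _ (Independent-⊆ (p─q⊆p S ⁅ x ⁆) ind)
                      (∉⇒⊆without₂ (x∉p-x S x) (x∉p⇒x∉p-y x (Independent⇒∉ ind x∈S x~y)))))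
    ... | no x∉S  = ≤-trans (∣p∣≤1+∣p-x∣ S y) (s≤s (∣S∣≤αOn G _ (Independent-⊆ (p─q⊆p S ⁅ y ⁆) ind)
                      (∉⇒⊆without₂ (x∉p⇒x∉p-y y x∉S) (x∉p-x S y))))

  αOn-without₂≤α∸1 : (∀ {S} → Independent G S → x ∉ S → y ∉ S → LargerIndependentSet S) →
    αOn G (without₂ x y) ≤ α G ∸ 1
  αOn-without₂≤α∸1 augment = αOn≤ G _ bound
    where
    bound : ∀ {S} → Independent G S → S ⊆ without₂ x y → ∣ S ∣ ≤ α G ∸ 1
    bound ind S⊆W with augment ind (proj₁ (⊆without₂⇒∉ S⊆W)) (proj₂ (⊆without₂⇒∉ S⊆W))
    ... | T , indT , ∣S∣<∣T∣ = ∸-monoˡ-≤ 1 (≤-trans ∣S∣<∣T∣ (∣S∣≤αOn G ⊤ indT ⊆⊤))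

module _ {G : Graph n} {f : Fin 8 → Fin n} (subcubic : Subcubic G) (induced : InducesΘ G f) where

  private
    v₂ v₆ x v₃ v₄ v₅ y : Fin n
    v₂ = f (# 1)
    v₆ = f (# 2)
    x  = f θx
    v₃ = f (# 4)
    v₄ = f (# 5)
    v₅ = f (# 6)
    y  = f θy

    Θ-edge : ∀ i j → ΘAdj i j ≡ true → adj G (f i) (f j) ≡ true
    Θ-edge i j = trans (proj₂ induced i j)

    Θ-non-edge : ∀ i j → ΘAdj i j ≡ false → adj G (f i) (f j) ≡ false
    Θ-non-edge i j = trans (proj₂ induced i j)

    Θ-distinct : ∀ {i j} → i ≢ j → f i ≢ f j
    Θ-distinct i≢j = i≢j ∘ proj₁ induced

    neighbours-outside : ∀ i a b c → ΘAdj i a ≡ true → ΘAdj i b ≡ true → ΘAdj i c ≡ true →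
      a ≢ b → a ≢ c → b ≢ c → ∀ {S} → f a ∉ S → f b ∉ S → f c ∉ S → NoNeighbourIn G (f i) S
    neighbours-outside i a b c i~a i~b i~c a≢b a≢c b≢c fa∉S fb∉S fc∉S fi~w w∈S
      with degree≤3⇒neighbours G (subcubic (f i)) (Θ-distinct a≢b) (Θ-distinct a≢c) (Θ-distinct b≢c)
             (Θ-edge i a i~a) (Θ-edge i b i~b) (Θ-edge i c i~c) fi~w
    ... | inj₁ refl        = fa∉S w∈S
    ... | inj₂ (inj₁ refl) = fb∉S w∈S
    ... | inj₂ (inj₂ refl) = fc∉S w∈S

    x-free : ∀ {S} → v₂ ∉ S → v₆ ∉ S → y ∉ S → NoNeighbourIn G x S
    x-free = neighbours-outside θx (# 1) (# 2) θy refl refl refl (λ ()) (λ ()) (λ ())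

    y-free : ∀ {S} → v₃ ∉ S → v₅ ∉ S → x ∉ S → NoNeighbourIn G y S
    y-free = neighbours-outside θy (# 4) (# 6) θx refl refl refl (λ ()) (λ ()) (λ ())

    v₃-free : ∀ {S} → v₂ ∉ S → v₄ ∉ S → y ∉ S → NoNeighbourIn G v₃ S
    v₃-free = neighbours-outside (# 4) (# 1) (# 5) θy refl refl refl (λ ()) (λ ()) (λ ())

    v₅-free : ∀ {S} → v₆ ∉ S → v₄ ∉ S → y ∉ S → NoNeighbourIn G v₅ S
    v₅-free = neighbours-outside (# 6) (# 2) (# 5) θy refl refl refl (λ ()) (λ ()) (λ ())

  -- Since 23 and 65 are edges, the last two clauses are the only remaining configurations.
  Θ-augment : ∀ {S} → Independent G S → x ∉ S → y ∉ S → LargerIndependentSet S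
  Θ-augment {S} ind x∉S y∉S with v₂ ∈? S | v₆ ∈? S | v₃ ∈? S | v₅ ∈? S
  ... | no v₂∉S  | no v₆∉S  | _        | _        = extend ind x∉S (x-free v₂∉S v₆∉S y∉S)
  ... | _        | _        | no v₃∉S  | no v₅∉S  = extend ind y∉S (y-free v₃∉S v₅∉S x∉S)
  ... | yes v₂∈S | _        | yes v₃∈S | _        =
    contradiction v₃∈S (Independent⇒∉ ind v₂∈S (Θ-edge (# 1) (# 4) refl))
  ... | _        | yes v₆∈S | _        | yes v₅∈S =
    contradiction v₅∈S (Independent⇒∉ ind v₆∈S (Θ-edge (# 2) (# 6) refl))
  ... | yes v₂∈S | no v₆∉S  | no v₃∉S  | yes v₅∈S =
    exchange ind x∉S v₃∉S (Θ-distinct (λ ())) (Θ-non-edge (# 4) θx refl)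
      (x-free (x∉p-x S v₂) (x∉p⇒x∉p-y v₂ v₆∉S) (x∉p⇒x∉p-y v₂ y∉S))
      (v₃-free (x∉p-x S v₂) (x∉p⇒x∉p-y v₂ v₄∉S) (x∉p⇒x∉p-y v₂ y∉S))
    where
    v₄∉S : v₄ ∉ S
    v₄∉S = Independent⇒∉ ind v₅∈S (Θ-edge (# 6) (# 5) refl)
  ... | no v₂∉S  | yes v₆∈S | yes v₃∈S | no v₅∉S  =
    exchange ind x∉S v₅∉S (Θ-distinct (λ ())) (Θ-non-edge (# 6) θx refl)
      (x-free (x∉p⇒x∉p-y v₆ v₂∉S) (x∉p-x S v₆) (x∉p⇒x∉p-y v₆ y∉S))
      (v₅-free (x∉p-x S v₆) (x∉p⇒x∉p-y v₆ v₄∉S) (x∉p⇒x∉p-y v₆ y∉S))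
    where
    v₄∉S : v₄ ∉ S
    v₄∉S = Independent⇒∉ ind v₃∈S (Θ-edge (# 4) (# 5) refl)

lemma7 : ∀ {n} (G : Graph n) (f : Fin 8 → Fin n) →
    Subcubic G → InducesΘ G f →
    αOn G (without₂ (f θx) (f θy)) ≡ α G ∸ 1
lemma7 G f subcubic induced = ≤-antisym
  (αOn-without₂≤α∸1 G (Θ-augment subcubic induced))
  (∸-monoˡ-≤ 1 (α≤1+αOn-without₂ G (proj₂ induced θx θy)))
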